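{- Let $s$ and $t$ be terms such that $s$ or $t$ is a variable and $s$ and $t$ cannot be unified. Then $s$ and $t$ are separated in some finite algebra.
   Context: Terms are built from variables in an algebraic language with (possibly infinitely many) operation symbols of finite arity, constants allowed as $0$-ary symbols. Terms $s$ and $t$ can be unified if there is a substitution of terms for the variables (applied simultaneously to both) that makes $s$ and $t$ into the same term. An algebra $\mathbf{A}$ of this language separates $s(x_1,\dots,x_k)$ and $t(x_1,\dots,x_k)$ if $s(a_1,\dots,a_k)\neq t(a_1,\dots,a_k)$ for all $a_1,\dots,a_k\in A$. -}

module Defs where

open import Data.Nat using (ℕ)
open import Data.Fin using (Fin)
open import Data.Vec using (Vec; []; _∷_)
open import Data.Product using (Σ; ∃; _,_)
open import Data.Sum using (_⊎_)
open import Function.Bundles using (_↔_)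
open import Relation.Binary.PropositionalEquality using (_≡_; _≢_)

record Language : Set₁ where
  field
    Op    : Set
    arity : Op → ℕ

module _ (L : Language) where
  open Language L

  data Term : Set where
    var : ℕ → Term
    op  : (f : Op) → Vec Term (arity f) → Term

  Subst : Set
  Subst = ℕ → Term

  mutual
    _[_] : Term → Subst → Term
    var x  [ σ ] = σ x
    op f ts [ σ ] = op f (substVec ts σ)

    substVec : ∀ {n} → Vec Term n → Subst → Vec Term n
    substVec []       σ = []
    substVec (t ∷ ts) σ = (t [ σ ]) ∷ substVec ts σ

  Unifiable : Term → Term → Set
  Unifiable s t = Σ Subst λ σ → s [ σ ] ≡ t [ σ ]

  IsVar : Term → Set
  IsVar s = ∃ λ x → s ≡ var x

  record Algebra : Set₁ where
    field
      Carrier : Set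
      ⟦_⟧     : (f : Op) → Vec Carrier (arity f) → Carrier

  module _ (A : Algebra) where
    open Algebra A

    mutual
      eval : (ℕ → Carrier) → Term → Carrier
      eval ρ (var x)   = ρ x
      eval ρ (op f ts) = ⟦ f ⟧ (evalVec ρ ts)

      evalVec : ∀ {n} → (ℕ → Carrier) → Vec Term n → Vec Carrier n
      evalVec ρ []       = []
      evalVec ρ (t ∷ ts) = eval ρ t ∷ evalVec ρ ts

    Separates : Term → Term → Set
    Separates s t = ∀ (ρ : ℕ → Carrier) → eval ρ s ≢ eval ρ t

  record IsFinite (A : Algebra) : Set where
    field
      size    : ℕ
      finite  : Algebra.Carrier A ↔ Fin size
      element : Algebra.Carrier A

-- If x does not occur in t, the substitution x ↦ t unifies x and t, and if t is x itself they
-- are trivially unified; so x occurs in t strictly below the root, along a path of argument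
-- positions i₀ i₁ … i₍ₖ₋₁₎ with k ≥ 1. Take as carrier the bit vectors of length k, with bit
-- positions read modulo k. Any symbol g computes bit j of its value as bit j + 1 of its
-- argument number i_j, negated when j = 0. Following the path down, bit 0 of the value of t is
-- then the negation of bit k, i.e. of bit 0, of the value of x.
module Submission where

open import Defs
open import Data.Bool using (Bool; false; not; _xor_)
open import Data.Bool.Properties using (not-¬)
open import Data.Empty using (⊥-elim)
open import Data.Fin using (Fin; toℕ; fromℕ<) renaming (zero to fzero; suc to fsuc)
open import Data.Fin.Properties using (2↔Bool; *↔×; fromℕ<-toℕ; toℕ-fromℕ<; fromℕ<-cong; toℕ<n)
open import Data.List using (List; []; _∷_; length; drop; head)
open import Data.Maybe using (just; nothing)
open import Data.Nat using (ℕ; zero; suc; _+_; _^_; _<_; _≡ᵇ_; NonZero; s≤s; z≤n)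
open import Data.Nat.DivMod using (_mod_; m<n⇒m%n≡m; [m+n]%n≡m%n)
open import Data.Nat.Properties using (_≟_; _<?_; +-suc; +-identityʳ; m<m+n)
open import Data.Product using (Σ; _×_; _,_)
open import Data.Product.Function.NonDependent.Propositional using (_×-cong_)
open import Data.Sum using (_⊎_; inj₁; inj₂)
open import Data.Vec using (Vec; []; _∷_; lookup; tabulate; replicate)
open import Data.Vec.Properties using (lookup∘tabulate)
open import Function.Bundles using (_↔_; mk↔ₛ′)
open import Function.Properties.Inverse using (↔-trans; ↔-sym)
open import Relation.Nullary using (¬_; yes; no)
open import Relation.Binary.PropositionalEquality
  using (_≡_; _≢_; refl; sym; trans; cong; cong₂; subst; module ≡-Reasoning)

Vec↔Fin^ : ∀ {A : Set} {m} → A ↔ Fin m → ∀ n → Vec A n ↔ Fin (m ^ n)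
Vec↔Fin^ A↔m zero = mk↔ₛ′ (λ _ → fzero) (λ _ → []) (λ { fzero → refl ; (fsuc ()) }) (λ { [] → refl })
Vec↔Fin^ {m = m} A↔m (suc n) =
  ↔-trans uncons (↔-trans (A↔m ×-cong Vec↔Fin^ A↔m n) (↔-sym (*↔× {m} {m ^ n})))
  where
  uncons : Vec _ (suc n) ↔ (_ × Vec _ n)
  uncons = mk↔ₛ′ (λ { (a ∷ as) → a , as }) (λ { (a , as) → a ∷ as })
                 (λ { (a , as) → refl }) (λ { (a ∷ as) → refl })

drop-suc : ∀ {A : Set} j (xs : List A) {y ys} → drop j xs ≡ y ∷ ys → drop (suc j) xs ≡ ys
drop-suc zero    (x ∷ xs) refl = refl
drop-suc (suc j) (x ∷ xs) eq   = drop-suc j xs eq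

module _ (L : Language) where
  open Language L

  data Occurs (x : ℕ) : Term L → Set where
    here  : Occurs x (var x)
    under : ∀ f ts (i : Fin (arity f)) → Occurs x (lookup ts i) → Occurs x (op f ts)

  path : ∀ {x u} → Occurs x u → List ℕ
  path here             = []
  path (under f ts i o) = toℕ i ∷ path o

  mutual
    occurs-or-fixed : ∀ x u (σ : Subst L) → (∀ y → y ≢ x → σ y ≡ var y) →
                      Occurs x u ⊎ _[_] L u σ ≡ u
    occurs-or-fixed x (var y) σ fixes with y ≟ x
    ... | yes refl = inj₁ here
    ... | no y≢x   = inj₂ (fixes y y≢x)
    occurs-or-fixed x (op f ts) σ fixes with occursVec-or-fixed x ts σ fixes
    ... | inj₁ (i , o) = inj₁ (under f ts i o)
    ... | inj₂ eq      = inj₂ (cong (op f) eq)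

    occursVec-or-fixed : ∀ x {n} (ts : Vec (Term L) n) (σ : Subst L) →
                         (∀ y → y ≢ x → σ y ≡ var y) →
                         (Σ (Fin n) λ i → Occurs x (lookup ts i)) ⊎ substVec L ts σ ≡ ts
    occursVec-or-fixed x []       σ fixes = inj₂ refl
    occursVec-or-fixed x (t ∷ ts) σ fixes with occurs-or-fixed x t σ fixes
    ... | inj₁ o = inj₁ (fzero , o)
    ... | inj₂ eq with occursVec-or-fixed x ts σ fixes
    ...   | inj₁ (i , o) = inj₁ (fsuc i , o)
    ...   | inj₂ eqs     = inj₂ (cong₂ _∷_ eq eqs)

  _≔_ : ℕ → Term L → Subst L
  (x ≔ t) y with y ≟ x
  ... | yes _ = t
  ... | no  _ = var y

  ≔-self : ∀ x t → (x ≔ t) x ≡ t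
  ≔-self x t with x ≟ x
  ... | yes _  = refl
  ... | no x≢x = ⊥-elim (x≢x refl)

  ≔-other : ∀ x t y → y ≢ x → (x ≔ t) y ≡ var y
  ≔-other x t y y≢x with y ≟ x
  ... | yes y≡x = ⊥-elim (y≢x y≡x)
  ... | no  _   = refl

  module PathAlgebra (w : List ℕ) .{{_ : NonZero (length w)}} where

    K : ℕ
    K = length w

    bit : ℕ → Vec Bool K → Bool
    bit j v = lookup v (j mod K)

    bit-period : ∀ v → bit K v ≡ bit 0 v
    bit-period v = cong (lookup v) (fromℕ<-cong _ _ ([m+n]%n≡m%n 0 K) _ _)

    bitOp : (g : Op) → Vec (Vec Bool K) (arity g) → ℕ → Bool
    bitOp g args j with head (drop j w)
    ... | nothing = false
    ... | just i with i <? arity g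
    ...   | no  _   = false
    ...   | yes i<n = (j ≡ᵇ 0) xor bit (suc j) (lookup args (fromℕ< i<n))

    algebra : Algebra L
    algebra = record
      { Carrier = Vec Bool K
      ; ⟦_⟧     = λ g args → tabulate (λ q → bitOp g args (toℕ q))
      }

    algebra-finite : IsFinite L algebra
    algebra-finite = record
      { size    = 2 ^ K
      ; finite  = Vec↔Fin^ (↔-sym 2↔Bool) K
      ; element = replicate K false
      }

    open Algebra algebra using (⟦_⟧)

    bit-⟦⟧ : ∀ g args {j} → j < K → bit j (⟦ g ⟧ args) ≡ bitOp g args j
    bit-⟦⟧ g args {j} j<K = begin
      lookup (tabulate (λ q → bitOp g args (toℕ q))) (j mod K) ≡⟨ lookup∘tabulate _ (j mod K) ⟩
      bitOp g args (toℕ (j mod K))                            ≡⟨ cong (bitOp g args) toℕ-j-mod-K ⟩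
      bitOp g args j                                          ∎
      where
      open ≡-Reasoning
      toℕ-j-mod-K : toℕ (j mod K) ≡ j
      toℕ-j-mod-K = trans (toℕ-fromℕ< _) (m<n⇒m%n≡m j<K)

    bitOp-reads : ∀ g args j (i : Fin (arity g)) → head (drop j w) ≡ just (toℕ i) →
                  bitOp g args j ≡ (j ≡ᵇ 0) xor bit (suc j) (lookup args i)
    bitOp-reads g args j i eq rewrite eq with toℕ i <? arity g
    ... | yes i<n = cong (λ k → (j ≡ᵇ 0) xor bit (suc j) (lookup args k)) (fromℕ<-toℕ i i<n)
    ... | no  i≮n = ⊥-elim (i≮n (toℕ<n i))

    evalVec-lookup : ∀ ρ {n} (ts : Vec (Term L) n) i →
                     lookup (evalVec L algebra ρ ts) i ≡ eval L algebra ρ (lookup ts i)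
    evalVec-lookup ρ (t ∷ ts) fzero    = refl
    evalVec-lookup ρ (t ∷ ts) (fsuc i) = evalVec-lookup ρ ts i

    bit-eval-step : ∀ ρ f ts (i : Fin (arity f)) j → j < K → head (drop j w) ≡ just (toℕ i) →
                    bit j (eval L algebra ρ (op f ts)) ≡
                    (j ≡ᵇ 0) xor bit (suc j) (eval L algebra ρ (lookup ts i))
    bit-eval-step ρ f ts i j j<K reads = begin
      bit j (⟦ f ⟧ (evalVec L algebra ρ ts))                         ≡⟨ bit-⟦⟧ f _ j<K ⟩
      bitOp f (evalVec L algebra ρ ts) j                             ≡⟨ bitOp-reads f _ j i reads ⟩
      (j ≡ᵇ 0) xor bit (suc j) (lookup (evalVec L algebra ρ ts) i)  ≡⟨ cong (λ a → (j ≡ᵇ 0) xor bit (suc j) a)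
                                                                              (evalVec-lookup ρ ts i) ⟩
      (j ≡ᵇ 0) xor bit (suc j) (eval L algebra ρ (lookup ts i))     ∎
      where open ≡-Reasoning

    bit-eval-path : ∀ ρ {x u} (o : Occurs x u) j → drop (suc j) w ≡ path o →
                    suc j + length (path o) ≡ K → bit (suc j) (eval L algebra ρ u) ≡ bit K (ρ x)
    bit-eval-path ρ {x} here j _ ends = cong (λ k → bit k (ρ x)) (trans (sym (+-identityʳ (suc j))) ends)
    bit-eval-path ρ (under f ts i o) j reads ends =
      trans (bit-eval-step ρ f ts i (suc j) sj<K (cong head reads))
            (bit-eval-path ρ o (suc j) (drop-suc (suc j) w reads) (trans (sym (+-suc (suc j) _)) ends))
      where
      sj<K : suc j < K
      sj<K = subst (suc j <_) ends (m<m+n (suc j) (s≤s z≤n))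

  separates-proper : ∀ x f ts (i : Fin (arity f)) (o : Occurs x (lookup ts i)) →
                     Σ (Algebra L) λ A → IsFinite L A × Separates L A (var x) (op f ts)
  separates-proper x f ts i o = algebra , algebra-finite , separates
    where
    open PathAlgebra (path (under f ts i o))
    separates : Separates L algebra (var x) (op f ts)
    separates ρ ρx≡t = not-¬ refl (begin
      bit 0 (ρ x)                                            ≡⟨ cong (bit 0) ρx≡t ⟩
      bit 0 (eval L algebra ρ (op f ts))                     ≡⟨ bit-eval-step ρ f ts i 0 (s≤s z≤n) refl ⟩
      not (bit 1 (eval L algebra ρ (lookup ts i)))           ≡⟨ cong not (bit-eval-path ρ o 0 refl refl) ⟩
      not (bit K (ρ x))                                      ≡⟨ cong not (bit-period (ρ x)) ⟩
      not (bit 0 (ρ x))                                      ∎)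
      where open ≡-Reasoning

  var-separable : ∀ x t → ¬ Unifiable L (var x) t →
                  Σ (Algebra L) λ A → IsFinite L A × Separates L A (var x) t
  var-separable x t ¬unif with occurs-or-fixed x t (x ≔ t) (≔-other x t)
  ... | inj₁ here             = ⊥-elim (¬unif (var , refl))
  ... | inj₁ (under f ts i o) = separates-proper x f ts i o
  ... | inj₂ fixed            = ⊥-elim (¬unif (x ≔ t , trans (≔-self x t) (sym fixed)))

lemma3p2 : (L : Language) (s t : Term L) →
    (IsVar L s ⊎ IsVar L t) → ¬ Unifiable L s t →
    Σ (Algebra L) λ A → IsFinite L A × Separates L A s t
lemma3p2 L s t (inj₁ (x , refl)) ¬unif = var-separable L x t ¬unif
lemma3p2 L s t (inj₂ (x , refl)) ¬unif with var-separable L x s (λ { (σ , eq) → ¬unif (σ , sym eq) })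
... | A , finite , separates = A , finite , λ ρ eq → separates ρ (sym eq)
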